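{- Let $f$ be a Boolean formula in the variables $x_1,\dots,x_n$ built from the connectives $\bigvee$ (unbounded fan-in) and $\neg$. If $f$ is satisfiable, then the polynomials of $\mathrm{POLY}(f)$ have a common $0/1$ root (i.e. there is a $0/1$ assignment to all variables $x_i,y_g,z_{g_1,g}$ on which every polynomial of $\mathrm{POLY}(f)$ evaluates to $0$).
   Context: For subformulas $g_1,g_2$ of $f$, write $g_1\rightarrow g_2$ if $g_1$ is an input to $g_2$; fix a canonical ordering $<$ of the subformulas. For each subformula $g$ there is a variable $y_g$, and for each pair with $g_1\rightarrow g$ where the top connective of $g$ is $\bigvee$, there is a variable $z_{g_1,g}$. $\mathrm{POLY}(f)$ consists of the following integer polynomials: for each variable $x_i$: $y_{x_i}-x_i$; for each subformula $g$ with top connective $\bigvee$: $y_{g_1}z_{g_2,g}$ for all $g_1<g_2$ with $g_1\rightarrow g$, $g_2\rightarrow g$; $z_{g_1,g}y_{g_1}-z_{g_1,g}$ for all $g_1\rightarrow g$; and $y_g-\sum_{g_1\rightarrow g}z_{g_1,g}$; for each subformula $g$ with top connective $\neg$ and unique input $g_1$: $y_{g_1}+y_g-1$; and finally $y_f-1$. -}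

module Defs where

open import Data.Nat using (ℕ)
open import Data.Bool using (Bool; true; false; not; _∨_)
open import Data.Fin using (Fin)
import Data.Fin.Properties as FinP
open import Data.List using (List; []; _∷_; deduplicate; foldr)
open import Data.List.Membership.Propositional using (_∈_)
open import Data.Integer as ℤ using (ℤ)
open import Relation.Nullary using (Dec; yes; no)
open import Relation.Binary using (Rel; DecidableEquality)
open import Relation.Binary.PropositionalEquality using (_≡_; refl; cong; cong₂)
open import Level using (0ℓ)

data Formula (n : ℕ) : Set where
  var : Fin n → Formula n
  or  : List (Formula n) → Formula n
  neg : Formula n → Formula n

mutual
  ⟦_⟧ : ∀ {n} → Formula n → (Fin n → Bool) → Bool
  ⟦ var i ⟧ a = a i
  ⟦ or gs ⟧ a = ⟦ gs ⟧ˡ a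
  ⟦ neg g ⟧ a = not (⟦ g ⟧ a)

  ⟦_⟧ˡ : ∀ {n} → List (Formula n) → (Fin n → Bool) → Bool
  ⟦ [] ⟧ˡ a = false
  ⟦ g ∷ gs ⟧ˡ a = ⟦ g ⟧ a ∨ ⟦ gs ⟧ˡ a

Satisfiable : ∀ {n} → Formula n → Set
Satisfiable {n} f = Σ' (Fin n → Bool) (λ a → ⟦ f ⟧ a ≡ true)
  where
  open import Data.Product using () renaming (Σ to Σ')

mutual
  _≟F_ : ∀ {n} → DecidableEquality (Formula n)
  var i ≟F var j with FinP._≟_ i j
  ... | yes refl = yes refl
  ... | no ne = no λ { refl → ne refl }
  var _ ≟F or _ = no λ ()
  var _ ≟F neg _ = no λ ()
  or _ ≟F var _ = no λ ()
  or gs ≟F or hs with gs ≟L hs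
  ... | yes refl = yes refl
  ... | no ne = no λ { refl → ne refl }
  or _ ≟F neg _ = no λ ()
  neg _ ≟F var _ = no λ ()
  neg _ ≟F or _ = no λ ()
  neg g ≟F neg h with g ≟F h
  ... | yes refl = yes refl
  ... | no ne = no λ { refl → ne refl }

  _≟L_ : ∀ {n} → DecidableEquality (List (Formula n))
  [] ≟L [] = yes refl
  [] ≟L (_ ∷ _) = no λ ()
  (_ ∷ _) ≟L [] = no λ ()
  (g ∷ gs) ≟L (h ∷ hs) with g ≟F h | gs ≟L hs
  ... | yes refl | yes refl = yes refl
  ... | no ne | _ = no λ { refl → ne refl }
  ... | _ | no ne = no λ { refl → ne refl }

data _⇒_ {n} : Formula n → Formula n → Set where
  or-in  : ∀ {g₁ gs} → g₁ ∈ gs → g₁ ⇒ or gs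
  neg-in : ∀ {g₁} → g₁ ⇒ neg g₁

data Sub {n} : Formula n → Formula n → Set where
  self : ∀ {f} → Sub f f
  step : ∀ {g₁ g f} → g₁ ⇒ g → Sub g f → Sub g₁ f

data Var (n : ℕ) : Set where
  x : Fin n → Var n
  y : Formula n → Var n
  z : Formula n → Formula n → Var n

data Poly (n : ℕ) : Set where
  v    : Var n → Poly n
  con  : ℤ → Poly n
  _⊕_  : Poly n → Poly n → Poly n
  _⊗_  : Poly n → Poly n → Poly n
  _⊖_  : Poly n → Poly n → Poly n

infixl 6 _⊕_ _⊖_
infixl 7 _⊗_

eval : ∀ {n} → (Var n → ℤ) → Poly n → ℤ
eval ρ (v w)   = ρ w
eval ρ (con c) = c
eval ρ (p ⊕ q) = eval ρ p ℤ.+ eval ρ q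
eval ρ (p ⊗ q) = eval ρ p ℤ.* eval ρ q
eval ρ (p ⊖ q) = eval ρ p ℤ.- eval ρ q

sumZ : ∀ {n} → Formula n → List (Formula n) → Poly n
sumZ g gs = foldr (λ g₁ acc → v (z g₁ g) ⊕ acc) (con (ℤ.+ 0)) (deduplicate _≟F_ gs)

data POLY {n} (_<_ : Rel (Formula n) 0ℓ) (f : Formula n) : Poly n → Set where
  p-var  : (i : Fin n) → POLY _<_ f (v (y (var i)) ⊖ v (x i))
  p-pair : ∀ {gs g₁ g₂} → Sub (or gs) f → g₁ ∈ gs → g₂ ∈ gs → g₁ < g₂ →
           POLY _<_ f (v (y g₁) ⊗ v (z g₂ (or gs)))
  p-zy   : ∀ {gs g₁} → Sub (or gs) f → g₁ ∈ gs →
           POLY _<_ f (v (z g₁ (or gs)) ⊗ v (y g₁) ⊖ v (z g₁ (or gs)))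
  p-sum  : ∀ {gs} → Sub (or gs) f →
           POLY _<_ f (v (y (or gs)) ⊖ sumZ (or gs) gs)
  p-neg  : ∀ {g₁} → Sub (neg g₁) f →
           POLY _<_ f (v (y g₁) ⊕ v (y (neg g₁)) ⊖ con (ℤ.+ 1))
  p-top  : POLY _<_ f (v (y f) ⊖ con (ℤ.+ 1))

Common01Root : ∀ {n} → Rel (Formula n) 0ℓ → Formula n → Set
Common01Root {n} _<_ f =
  Σ' (Var n → ℤ) λ ρ →
    ((w : Var n) → ρ w ≡ ℤ.+ 0 ⊎' ρ w ≡ ℤ.+ 1) ×'
    (∀ p → POLY _<_ f p → eval ρ p ≡ ℤ.+ 0)
  where
  open import Data.Product using () renaming (Σ to Σ'; _×_ to _×'_)
  open import Data.Sum using () renaming (_⊎_ to _⊎'_)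

-- Take y_g to be the truth value of g under a satisfying assignment and let
-- z_{g₁,g} single out the <-least true input g₁ of each disjunction g.  Then
-- Σ z_{g₁,g} equals y_g, z_{g₁,g} = 1 forces y_{g₁} = 1, and y_{g₁} z_{g₂,g}
-- vanishes for g₁ < g₂ because a true g₁ below g₂ would contradict the
-- minimality of g₂.
module Submission where

open import Defs
open import Data.Nat using (ℕ)
open import Data.Bool using (Bool; true; false; not; _∨_)
open import Data.Bool.Properties using (∨-zeroʳ)
open import Data.Empty using (⊥)
open import Data.Fin using (Fin)
open import Data.Integer as ℤ using (ℤ; +_)
import Data.Integer.Properties as ℤP
open import Data.List using (List; []; _∷_; deduplicate; foldr)
open import Data.List.Membership.Propositional using (_∈_)
open import Data.List.Membership.Propositional.Properties using (∈-deduplicate⁺)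
open import Data.List.Relation.Unary.All as All using (All; []; _∷_)
open import Data.List.Relation.Unary.AllPairs using (_∷_)
open import Data.List.Relation.Unary.Any using (here; there)
open import Data.List.Relation.Unary.Unique.Propositional using (Unique)
open import Data.List.Relation.Unary.Unique.DecPropositional.Properties using (deduplicate-!)
open import Data.Product using (_,_; ∃)
open import Data.Sum using (_⊎_; inj₁; inj₂)
open import Level using (Level; 0ℓ; _⊔_)
open import Relation.Binary using (Rel; IsStrictTotalOrder; tri<; tri≈; tri>)
open import Relation.Binary.PropositionalEquality
  using (_≡_; _≢_; refl; sym; trans; cong; cong₂; ≢-sym)
open import Relation.Nullary using (¬_; yes; no; does; contradiction)
open import Relation.Nullary.Decidable using (dec-true; dec-false)

module LeastSatisfying {a ℓ : Level} {A : Set a} {_<_ : Rel A ℓ}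
  (sto : IsStrictTotalOrder _≡_ _<_) (p : A → Bool) where

  open IsStrictTotalOrder sto using (compare; irrefl) renaming (trans to <-trans)

  record IsLeast (xs : List A) (m : A) : Set (a ⊔ ℓ) where
    field
      member    : m ∈ xs
      satisfies : p m ≡ true
      minimal   : ∀ {x} → x ∈ xs → p x ≡ true → ¬ x < m

  open IsLeast

  cons-least : ∀ {x xs} → p x ≡ true →
               (∀ {y} → y ∈ xs → p y ≡ true → ¬ y < x) → IsLeast (x ∷ xs) x
  cons-least px below .member = here refl
  cons-least px below .satisfies = px
  cons-least px below .minimal (here refl) _ = irrefl refl
  cons-least px below .minimal (there y∈xs) = below y∈xs

  cons-keep : ∀ {x xs m} → (p x ≡ true → ¬ x < m) →
              IsLeast xs m → IsLeast (x ∷ xs) m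
  cons-keep x≮m lm .member = there (lm .member)
  cons-keep x≮m lm .satisfies = lm .satisfies
  cons-keep x≮m lm .minimal (here refl) = x≮m
  cons-keep x≮m lm .minimal (there y∈xs) = lm .minimal y∈xs

  least : (xs : List A) → All (λ x → p x ≡ false) xs ⊎ ∃ (IsLeast xs)
  least [] = inj₁ []
  least (u ∷ us) with p u in pu | least us
  ... | false | inj₁ none = inj₁ (pu ∷ none)
  ... | false | inj₂ (m , lm) = inj₂ (m , cons-keep (λ t → contradiction (trans (sym pu) t) λ ()) lm)
  ... | true  | inj₁ none =
    inj₂ (u , cons-least pu λ y∈us t → contradiction (trans (sym t) (All.lookup none y∈us)) λ ())
  ... | true  | inj₂ (m , lm) with compare u m
  ...   | tri< u<m _ _ = inj₂ (u , cons-least pu λ y∈us t y<u → lm .minimal y∈us t (<-trans y<u u<m))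
  ...   | tri≈ _ refl _ = inj₂ (m , cons-keep (λ _ → irrefl refl) lm)
  ...   | tri> u≮m _ _ = inj₂ (m , cons-keep (λ _ → u≮m) lm)

𝟙 : Bool → ℤ
𝟙 true = + 1
𝟙 false = + 0

𝟙-01 : ∀ b → 𝟙 b ≡ + 0 ⊎ 𝟙 b ≡ + 1
𝟙-01 true = inj₂ refl
𝟙-01 false = inj₁ refl

𝟙-*-disjoint : ∀ b c → (b ≡ true → c ≡ true → ⊥) → 𝟙 b ℤ.* 𝟙 c ≡ + 0
𝟙-*-disjoint true true disjoint = contradiction refl (disjoint refl)
𝟙-*-disjoint true false _ = refl
𝟙-*-disjoint false _ _ = refl

𝟙-*-implied : ∀ b c → (c ≡ true → b ≡ true) → 𝟙 c ℤ.* 𝟙 b ℤ.- 𝟙 c ≡ + 0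
𝟙-*-implied b false _ = refl
𝟙-*-implied b true implied rewrite implied refl = refl

𝟙-not : ∀ b → 𝟙 b ℤ.+ 𝟙 (not b) ℤ.- + 1 ≡ + 0
𝟙-not true = refl
𝟙-not false = refl

𝟙-cancel : ∀ b → 𝟙 b ℤ.- 𝟙 b ≡ + 0
𝟙-cancel b = ℤP.+-inverseʳ (𝟙 b)

module _ {n : ℕ} where

  sumZOver : Formula n → List (Formula n) → Poly n
  sumZOver g = foldr (λ g₁ acc → v (z g₁ g) ⊕ acc) (con (+ 0))

  module _ (σ : Var n → ℤ) {g : Formula n} where

    eval-sumZOver-zero : ∀ {L} → All (λ g₁ → σ (z g₁ g) ≡ + 0) L →
                         eval σ (sumZOver g L) ≡ + 0
    eval-sumZOver-zero [] = refl
    eval-sumZOver-zero (zero ∷ zeros) = cong₂ ℤ._+_ zero (eval-sumZOver-zero zeros)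

    eval-sumZOver-single : ∀ {m} → σ (z m g) ≡ + 1 →
                           (∀ {g₁} → g₁ ≢ m → σ (z g₁ g) ≡ + 0) →
                           ∀ {L} → Unique L → m ∈ L → eval σ (sumZOver g L) ≡ + 1
    eval-sumZOver-single one off (m∉L ∷ _) (here refl) =
      cong₂ ℤ._+_ one (eval-sumZOver-zero (All.map (λ m≢g₁ → off (≢-sym m≢g₁)) m∉L))
    eval-sumZOver-single one off (g₁∉L ∷ unique) (there m∈L) =
      cong₂ ℤ._+_ (off (All.lookup g₁∉L m∈L)) (eval-sumZOver-single one off unique m∈L)

module _ {n : ℕ} (a : Fin n → Bool) where

  ⟦⟧ˡ-false : ∀ {gs} → All (λ g → ⟦ g ⟧ a ≡ false) gs → ⟦ gs ⟧ˡ a ≡ false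
  ⟦⟧ˡ-false [] = refl
  ⟦⟧ˡ-false (false-g ∷ false-gs) = cong₂ _∨_ false-g (⟦⟧ˡ-false false-gs)

  ⟦⟧ˡ-true : ∀ {g gs} → g ∈ gs → ⟦ g ⟧ a ≡ true → ⟦ gs ⟧ˡ a ≡ true
  ⟦⟧ˡ-true (here refl) true-g rewrite true-g = refl
  ⟦⟧ˡ-true {gs = g′ ∷ _} (there g∈gs) true-g =
    trans (cong (⟦ g′ ⟧ a ∨_) (⟦⟧ˡ-true g∈gs true-g)) (∨-zeroʳ (⟦ g′ ⟧ a))

module ZeroOneRoot {n : ℕ} {_<_ : Rel (Formula n) 0ℓ}
  (sto : IsStrictTotalOrder _≡_ _<_) (a : Fin n → Bool) where

  open LeastSatisfying sto (λ g → ⟦ g ⟧ a)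
  open IsLeast

  Choice : List (Formula n) → Set
  Choice gs = All (λ g → ⟦ g ⟧ a ≡ false) gs ⊎ ∃ (IsLeast gs)

  chosen : ∀ {gs} → Choice gs → Formula n → Bool
  chosen (inj₁ _) _ = false
  chosen (inj₂ (m , _)) g₁ = does (m ≟F g₁)

  chosen-least : ∀ {gs g₁} (r : Choice gs) → chosen r g₁ ≡ true → IsLeast gs g₁
  chosen-least (inj₁ _) ()
  chosen-least {g₁ = g₁} (inj₂ (m , lm)) is-chosen with m ≟F g₁
  chosen-least (inj₂ (m , lm)) _ | yes refl = lm
  chosen-least (inj₂ (m , lm)) () | no _

  assignment : Var n → Bool
  assignment (x i) = a i
  assignment (y g) = ⟦ g ⟧ a
  assignment (z g₁ (or gs)) = chosen (least gs) g₁
  -- z_{g₁,g} occurs in POLY(f) only when g is a disjunction.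
  assignment (z _ _) = false

  ρ : Var n → ℤ
  ρ w = 𝟙 (assignment w)

  eval-sumZ : ∀ gs → eval ρ (sumZ (or gs) gs) ≡ 𝟙 (⟦ gs ⟧ˡ a)
  eval-sumZ gs with least gs in least≡
  ... | inj₁ none rewrite ⟦⟧ˡ-false a none =
    eval-sumZOver-zero ρ {g = or gs} {L = deduplicate _≟F_ gs}
      (All.tabulate λ {g₁} _ → cong (λ r → 𝟙 (chosen r g₁)) least≡)
  ... | inj₂ (m , lm) rewrite ⟦⟧ˡ-true a (lm .member) (lm .satisfies) =
    eval-sumZOver-single ρ
      (trans (ρ-z m) (cong 𝟙 (dec-true (m ≟F m) refl)))
      (λ g₁≢m → trans (ρ-z _) (cong 𝟙 (dec-false (m ≟F _) (≢-sym g₁≢m))))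
      (deduplicate-! _≟F_ gs) (∈-deduplicate⁺ _≟F_ (lm .member))
    where
    ρ-z : ∀ g₁ → ρ (z g₁ (or gs)) ≡ 𝟙 (does (m ≟F g₁))
    ρ-z g₁ = cong (λ r → 𝟙 (chosen r g₁)) least≡

  -- The subformula hypotheses are unused: the constraints hold at every gate.
  root : ∀ {f} → ⟦ f ⟧ a ≡ true → ∀ p → POLY _<_ f p → eval ρ p ≡ + 0
  root _ _ (p-var i) = 𝟙-cancel (a i)
  root _ _ (p-pair {gs} _ g₁∈gs _ g₁<g₂) =
    𝟙-*-disjoint _ _ λ true-g₁ chosen-g₂ →
      chosen-least (least gs) chosen-g₂ .minimal g₁∈gs true-g₁ g₁<g₂
  root _ _ (p-zy {gs} _ _) =
    𝟙-*-implied _ _ λ chosen-g₁ → chosen-least (least gs) chosen-g₁ .satisfies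
  root _ _ (p-sum {gs} _) =
    trans (cong (ℤ._-_ (𝟙 (⟦ gs ⟧ˡ a))) (eval-sumZ gs)) (𝟙-cancel (⟦ gs ⟧ˡ a))
  root _ _ (p-neg {g₁} _) = 𝟙-not (⟦ g₁ ⟧ a)
  root true-f _ p-top = cong (λ b → 𝟙 b ℤ.- + 1) true-f

mainTheorem4 : (n : ℕ) (_<_ : Rel (Formula n) 0ℓ) →
               IsStrictTotalOrder _≡_ _<_ →
               (f : Formula n) → Satisfiable f → Common01Root _<_ f
mainTheorem4 n _<_ sto f (a , f-true) = ρ , (λ w → 𝟙-01 (assignment w)) , root f-true
  where open ZeroOneRoot sto a
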